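{- Let $\Gamma$ be a finite abelian group, let $l\ge2$ and $k\ge2$ be integers, and let $f_0,\dots,f_{\max(k,l)-1},g_0,\dots,g_{l-1}:\Gamma\to\mathbb{C}$. Then $$\sum_{x\in\Gamma^{l-1}}\mathcal{C}_l(f_0,\dots,f_{l-1})(x)\,\mathcal{C}_l(g_0,\dots,g_{l-1})(x)=\sum_{z\in\Gamma}(f_0\circ g_0)(z)\cdots(f_{l-1}\circ g_{l-1})(z),$$ $$\sum_{x\in\Gamma^{l-1}}\mathcal{C}_l(f_0)(x)\cdots\mathcal{C}_l(f_{k-1})(x)=\sum_{y\in\Gamma^{k-1}}\mathcal{C}_k(f_0,\dots,f_{k-1})(y)^l,$$ and $$\sum_{x\in\Gamma^{l-1}}\mathcal{C}_l(f_0)(x)\,(\mathcal{C}_l(f_1)\circ\dots\circ\mathcal{C}_l(f_{k-1}))(x)=\sum_{z\in\Gamma}(f_0\circ\dots\circ f_{k-1})^l(z).$$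
   Context: For an abelian group $H$ and $g_1,\dots,g_m:H\to\mathbb{C}$, $\mathcal{C}_m(g_1,\dots,g_m)(x_1,\dots,x_{m-1})=\sum_{z\in H}g_1(z)g_2(z+x_1)\cdots g_m(z+x_{m-1})$, and $\mathcal{C}_m(g)$ means $\mathcal{C}_m(g,\dots,g)$ ($m$ copies). For $f,g:H\to\mathbb{C}$, $(f\circ g)(x)=\sum_{y\in H}f(y)g(y+x)$. Iterated $\circ$ is nested to the right: $h_1\circ h_2\circ\dots\circ h_r:=h_1\circ(h_2\circ(\cdots\circ h_r))$; in the third identity the operation $\circ$ between the functions $\mathcal{C}_l(f_j)$ is taken in $H=\Gamma^{l-1}$. -}

module Defs where

open import Level using (Level)
open import Data.Nat as ℕ using (ℕ; zero; suc; _≤_)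
open import Data.Fin using (Fin; zero; suc)
open import Data.Vec.Functional using (Vector; _∷_; zipWith)
open import Function.Bundles using (_↔_; Inverse)
open import Relation.Binary.PropositionalEquality using (_≡_)
open import Algebra.Bundles using (CommutativeRing)
open import Algebra.Structures using (IsAbelianGroup)

record FiniteAbelianGroup (a : Level) : Set (Level.suc a) where
  field
    Carrier        : Set a
    _+_            : Carrier → Carrier → Carrier
    0#             : Carrier
    -_             : Carrier → Carrier
    isAbelianGroup : IsAbelianGroup _≡_ _+_ 0# -_
    size           : ℕ
    enum           : Fin size ↔ Carrier

headF : ∀ {b} {X : Set b} {k : ℕ} → 1 ≤ k → (Fin k → X) → X
headF {k = suc k} _ h = h zero

tailF : ∀ {b} {X : Set b} {k : ℕ} → (Fin k → X) → Fin (ℕ.pred k) → X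
tailF {k = zero}  h ()
tailF {k = suc k} h i = h (suc i)

module _ {a c ℓ} (Γ : FiniteAbelianGroup a) (R : CommutativeRing c ℓ) where
  private
    module G = FiniteAbelianGroup Γ
    module R = CommutativeRing R
    A = R.Carrier

  sumFin : ∀ n → (Fin n → A) → A
  sumFin zero    h = R.0#
  sumFin (suc n) h = h zero R.+ sumFin n (λ i → h (suc i))

  prodFin : ∀ n → (Fin n → A) → A
  prodFin zero    h = R.1#
  prodFin (suc n) h = h zero R.* prodFin n (λ i → h (suc i))

  pow : A → ℕ → A
  pow x zero    = R.1#
  pow x (suc n) = x R.* pow x n

  ΣΓ : (G.Carrier → A) → A
  ΣΓ h = sumFin G.size (λ i → h (Inverse.to G.enum i))

  Tuple : ℕ → Set a
  Tuple m = Vector G.Carrier m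

  _⊕_ : ∀ {m} → Tuple m → Tuple m → Tuple m
  x ⊕ y = zipWith G._+_ x y

  ΣTuple : ∀ m → (Tuple m → A) → A
  ΣTuple zero    F = F (λ ())
  ΣTuple (suc m) F = ΣΓ (λ z → ΣTuple m (λ x → F (z ∷ x)))

  ext : ∀ {l} → Tuple (ℕ.pred l) → Fin l → G.Carrier
  ext {suc l} x zero    = G.0#
  ext {suc l} x (suc i) = x i

  𝒞 : ∀ l → (Fin l → G.Carrier → A) → Tuple (ℕ.pred l) → A
  𝒞 l g x = ΣΓ (λ z → prodFin l (λ i → g i (z G.+ ext x i)))

  _∘Γ_ : (G.Carrier → A) → (G.Carrier → A) → G.Carrier → A
  (f ∘Γ g) x = ΣΓ (λ y → f y R.* g (y G.+ x))

  convT : ∀ m → (Tuple m → A) → (Tuple m → A) → Tuple m → A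
  convT m F H x = ΣTuple m (λ y → F y R.* H (y ⊕ x))

  -- right-nested iterated ∘ of a family h_0 ∘ (h_1 ∘ (... ∘ h_{r-1})), r ≥ 1.
  -- (The value for the empty family r = 0 is an arbitrary convention, never used.)
  chainΓ : ∀ r → (Fin r → G.Carrier → A) → G.Carrier → A
  chainΓ zero          h = λ _ → R.0#
  chainΓ (suc zero)    h = h zero
  chainΓ (suc (suc r)) h = h zero ∘Γ chainΓ (suc r) (λ i → h (suc i))

  chainT : ∀ m r → (Fin r → Tuple m → A) → Tuple m → A
  chainT m zero          h = λ _ → R.0#
  chainT m (suc zero)    h = h zero
  chainT m (suc (suc r)) h = convT m (h zero) (chainT m (suc r) (λ i → h (suc i)))

-- Every identity is an instance of one fact: for n ≥ 1 the sum of
-- 𝒞ₙ(h₀,…,hₙ₋₁) over Γⁿ⁻¹ is the product of the sums of the hᵢ, because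
-- (z, z + x₁, …, z + xₙ₋₁) runs once through Γⁿ as (z, x) runs through Γ × Γⁿ⁻¹.
-- A product 𝒞(F)(x) 𝒞(H)(x) is itself a sum over w of the correlation of the
-- functions y ↦ Fᵢ(y) Hᵢ(y + w), which gives the first identity, and the third
-- follows from it once a convolution of correlations is seen to be the
-- correlation of the convolutions. The second identity comes from writing both
-- sides as one sum over Γ × Γˡ⁻¹ × Γᵏ⁻¹ of ∏ᵢ ∏ⱼ fⱼ(b + xᵢ + yⱼ).
module Submission where

open import Defs
open import Data.Nat using (ℕ; zero; suc; pred; _⊔_; _≤_; s≤s)
open import Data.Nat.Properties using (m≤m⊔n; m≤n⊔m; <⇒≤)
open import Data.Fin using (Fin; zero; suc; inject≤)
open import Data.Fin.Permutation using (Permutation)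
open import Data.Product using (_×_; _,_)
open import Data.Vec.Functional using (Vector; _∷_)
open import Function using (_∘_; const)
open import Function.Bundles using (_↔_; Inverse; mk↔ₛ′)
open import Function.Properties.Inverse using (↔-trans; ↔-sym)
open import Relation.Binary.Core using (_Preserves_⟶_)
open import Relation.Binary.PropositionalEquality as ≡ using (_≡_; _≗_)
open import Algebra.Bundles using (CommutativeRing; AbelianGroup)
import Algebra.Properties.CommutativeMonoid.Sum as CommutativeMonoidSum
import Algebra.Properties.CommutativeSemigroup as CommutativeSemigroupProperties
import Algebra.Properties.Group as GroupProperties
import Algebra.Properties.Semiring.Sum as SemiringSum
import Relation.Binary.Reasoning.Setoid as SetoidReasoning

module _ {a c ℓ} (Γ : FiniteAbelianGroup a) (R : CommutativeRing c ℓ) where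
  open FiniteAbelianGroup Γ using (size; enum) renaming (Carrier to G)

  abelianGroup : AbelianGroup a a
  abelianGroup = record { isAbelianGroup = FiniteAbelianGroup.isAbelianGroup Γ }

  open AbelianGroup abelianGroup using (_∙_; ε; _⁻¹; commutativeSemigroup; group)
    renaming (assoc to ∙-assoc; identityʳ to ∙-identityʳ)
  open CommutativeSemigroupProperties commutativeSemigroup using (xy∙z≈xz∙y)
  open GroupProperties group using (\\-leftDividesˡ; \\-leftDividesʳ)
  open CommutativeRing R hiding (zero)
  open SetoidReasoning setoid
  open SemiringSum semiring
    using (sum; sum-cong-≋; ∑-comm; sum-permute; *-distribˡ-sum; *-distribʳ-sum)
  open CommutativeMonoidSum *-commutativeMonoid using ()
    renaming (sum to prod; sum-cong-≋ to prod-cong-≋; ∑-comm to ∏-comm; ∑-distrib-+ to ∏-distrib-*)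

  private
    ∑Γ : (G → Carrier) → Carrier
    ∑Γ = ΣΓ Γ R
    ∑T : ∀ m → (Vector G m → Carrier) → Carrier
    ∑T = ΣTuple Γ R
    ∏ : ∀ n → (Fin n → Carrier) → Carrier
    ∏ = prodFin Γ R
    C : ∀ n → (Fin n → G → Carrier) → Vector G (pred n) → Carrier
    C = 𝒞 Γ R
    0∷ : ∀ {n} → Vector G n → Fin (suc n) → G
    0∷ = ext Γ R
    to : Fin size → G
    to = Inverse.to enum

  sumFin≡sum : ∀ n (h : Fin n → Carrier) → sumFin Γ R n h ≡ sum h
  sumFin≡sum zero    h = ≡.refl
  sumFin≡sum (suc n) h = ≡.cong (h zero +_) (sumFin≡sum n (h ∘ suc))

  prodFin≡prod : ∀ n (h : Fin n → Carrier) → ∏ n h ≡ prod h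
  prodFin≡prod zero    h = ≡.refl
  prodFin≡prod (suc n) h = ≡.cong (h zero *_) (prodFin≡prod n (h ∘ suc))

  prodFin-cong : ∀ n {h h′ : Fin n → Carrier} → (∀ i → h i ≈ h′ i) → ∏ n h ≈ ∏ n h′
  prodFin-cong n {h} {h′} h≈h′ = begin
    ∏ n h    ≡⟨ prodFin≡prod n h ⟩
    prod h   ≈⟨ prod-cong-≋ h≈h′ ⟩
    prod h′  ≡⟨ prodFin≡prod n h′ ⟨
    ∏ n h′   ∎

  prodFin-distrib-* : ∀ n (h h′ : Fin n → Carrier) → ∏ n (λ i → h i * h′ i) ≈ ∏ n h * ∏ n h′
  prodFin-distrib-* n h h′ = begin
    ∏ n (λ i → h i * h′ i)  ≡⟨ prodFin≡prod n (λ i → h i * h′ i) ⟩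
    prod (λ i → h i * h′ i) ≈⟨ ∏-distrib-* h h′ ⟩
    prod h * prod h′        ≡⟨ ≡.cong₂ _*_ (prodFin≡prod n h) (prodFin≡prod n h′) ⟨
    ∏ n h * ∏ n h′          ∎

  prodFin-comm : ∀ m n (F : Fin m → Fin n → Carrier) →
    ∏ m (λ i → ∏ n (F i)) ≈ ∏ n (λ j → ∏ m (λ i → F i j))
  prodFin-comm m n F = begin
    ∏ m (λ i → ∏ n (F i))            ≈⟨ reflexive (prodFin≡prod m (λ i → ∏ n (F i))) ⟩
    prod (λ i → ∏ n (F i))           ≈⟨ prod-cong-≋ (λ i → reflexive (prodFin≡prod n (F i))) ⟩
    prod (λ i → prod (F i))          ≈⟨ ∏-comm F ⟩
    prod (λ j → prod (λ i → F i j))  ≈⟨ prod-cong-≋ (λ j → reflexive (prodFin≡prod m (λ i → F i j))) ⟨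
    prod (λ j → ∏ m (λ i → F i j))   ≈⟨ reflexive (prodFin≡prod n (λ j → ∏ m (λ i → F i j))) ⟨
    ∏ n (λ j → ∏ m (λ i → F i j))    ∎

  pow≈prodFin-const : ∀ x n → pow Γ R x n ≈ ∏ n (const x)
  pow≈prodFin-const x zero    = refl
  pow≈prodFin-const x (suc n) = *-congˡ (pow≈prodFin-const x n)

  ΣΓ≈sum : ∀ h → ∑Γ h ≈ sum (h ∘ to)
  ΣΓ≈sum h = reflexive (sumFin≡sum size (h ∘ to))

  ΣΓ-cong : ∀ {h h′ : G → Carrier} → (∀ z → h z ≈ h′ z) → ∑Γ h ≈ ∑Γ h′
  ΣΓ-cong {h} {h′} h≈h′ = begin
    ∑Γ h            ≈⟨ ΣΓ≈sum h ⟩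
    sum (h ∘ to)    ≈⟨ sum-cong-≋ (h≈h′ ∘ to) ⟩
    sum (h′ ∘ to)   ≈⟨ ΣΓ≈sum h′ ⟨
    ∑Γ h′           ∎

  ΣΓ-distribˡ : ∀ x h → x * ∑Γ h ≈ ∑Γ (λ z → x * h z)
  ΣΓ-distribˡ x h = begin
    x * ∑Γ h                 ≈⟨ *-congˡ (ΣΓ≈sum h) ⟩
    x * sum (h ∘ to)         ≈⟨ *-distribˡ-sum x (h ∘ to) ⟩
    sum (λ i → x * h (to i)) ≈⟨ ΣΓ≈sum (λ z → x * h z) ⟨
    ∑Γ (λ z → x * h z)       ∎

  ΣΓ-distribʳ : ∀ x h → ∑Γ h * x ≈ ∑Γ (λ z → h z * x)
  ΣΓ-distribʳ x h = begin
    ∑Γ h * x                 ≈⟨ *-congʳ (ΣΓ≈sum h) ⟩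
    sum (h ∘ to) * x         ≈⟨ *-distribʳ-sum x (h ∘ to) ⟩
    sum (λ i → h (to i) * x) ≈⟨ ΣΓ≈sum (λ z → h z * x) ⟨
    ∑Γ (λ z → h z * x)       ∎

  ΣΓ-comm : ∀ (F : G → G → Carrier) → ∑Γ (λ z → ∑Γ (F z)) ≈ ∑Γ (λ w → ∑Γ (λ z → F z w))
  ΣΓ-comm F = begin
    ∑Γ (λ z → ∑Γ (F z))                             ≈⟨ ΣΓ≈sum (λ z → ∑Γ (F z)) ⟩
    sum (λ i → ∑Γ (F (to i)))                       ≈⟨ sum-cong-≋ (λ i → ΣΓ≈sum (F (to i))) ⟩
    sum (λ i → sum (λ j → F (to i) (to j)))         ≈⟨ ∑-comm (λ i j → F (to i) (to j)) ⟩
    sum (λ j → sum (λ i → F (to i) (to j)))         ≈⟨ sum-cong-≋ (λ j → ΣΓ≈sum (λ z → F z (to j))) ⟨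
    sum (λ j → ∑Γ (λ z → F z (to j)))               ≈⟨ ΣΓ≈sum (λ w → ∑Γ (λ z → F z w)) ⟨
    ∑Γ (λ w → ∑Γ (λ z → F z w))                     ∎

  translation : G → G ↔ G
  translation b = mk↔ₛ′ (b ∙_) (b ⁻¹ ∙_) (\\-leftDividesˡ b) (\\-leftDividesʳ b)

  ΣΓ-translate : ∀ b (h : G → Carrier) → ∑Γ (λ z → h (b ∙ z)) ≈ ∑Γ h
  ΣΓ-translate b h = begin
    ∑Γ (λ z → h (b ∙ z))                 ≈⟨ ΣΓ≈sum (λ z → h (b ∙ z)) ⟩
    sum (λ i → h (b ∙ to i))
      ≈⟨ sum-cong-≋ (λ i → reflexive (≡.cong h (Inverse.strictlyInverseˡ enum (b ∙ to i)))) ⟨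
    sum (λ i → h (to (Inverse.to π i)))  ≈⟨ sum-permute (h ∘ to) π ⟨
    sum (h ∘ to)                         ≈⟨ ΣΓ≈sum h ⟨
    ∑Γ h                                 ∎
    where
    π : Permutation size size
    π = ↔-trans enum (↔-trans (translation b) (↔-sym enum))

  ∷-cong-≗ : ∀ {m} w {x y : Vector G m} → x ≗ y → (w ∷ x) ≗ (w ∷ y)
  ∷-cong-≗ w x≗y zero    = ≡.refl
  ∷-cong-≗ w x≗y (suc i) = x≗y i

  ΣTuple-cong : ∀ m {F F′ : Vector G m → Carrier} → (∀ x → F x ≈ F′ x) → ∑T m F ≈ ∑T m F′
  ΣTuple-cong zero    F≈F′ = F≈F′ _
  ΣTuple-cong (suc m) F≈F′ = ΣΓ-cong (λ z → ΣTuple-cong m (λ x → F≈F′ (z ∷ x)))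

  ΣTuple-distribˡ : ∀ m x (F : Vector G m → Carrier) → x * ∑T m F ≈ ∑T m (λ y → x * F y)
  ΣTuple-distribˡ zero    x F = refl
  ΣTuple-distribˡ (suc m) x F =
    trans (ΣΓ-distribˡ x (λ z → ∑T m (λ y → F (z ∷ y))))
          (ΣΓ-cong (λ z → ΣTuple-distribˡ m x (λ y → F (z ∷ y))))

  ΣTuple-ΣΓ-comm : ∀ m (F : Vector G m → G → Carrier) →
    ∑T m (λ x → ∑Γ (F x)) ≈ ∑Γ (λ z → ∑T m (λ x → F x z))
  ΣTuple-ΣΓ-comm zero    F = refl
  ΣTuple-ΣΓ-comm (suc m) F =
    trans (ΣΓ-cong (λ w → ΣTuple-ΣΓ-comm m (λ x → F (w ∷ x))))
          (ΣΓ-comm (λ w z → ∑T m (λ x → F (w ∷ x) z)))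

  ΣTuple-comm : ∀ m n (F : Vector G m → Vector G n → Carrier) →
    ∑T m (λ x → ∑T n (F x)) ≈ ∑T n (λ y → ∑T m (λ x → F x y))
  ΣTuple-comm zero    n F = refl
  ΣTuple-comm (suc m) n F =
    trans (ΣΓ-cong (λ w → ΣTuple-comm m n (λ x → F (w ∷ x))))
          (sym (ΣTuple-ΣΓ-comm n (λ y w → ∑T m (λ x → F (w ∷ x) y))))

  -- Translates of z ∷ x agree with (b ∙ z) ∷ (b ∙ x) only pointwise, so F has
  -- to respect _≗_ (there is no function extensionality).
  ΣTuple-translate : ∀ m b (F : Vector G m → Carrier) → F Preserves _≗_ ⟶ _≈_ →
    ∑T m (λ x → F (λ i → b ∙ x i)) ≈ ∑T m F
  ΣTuple-translate zero    b F F-resp = F-resp (λ ())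
  ΣTuple-translate (suc m) b F F-resp = begin
    ∑Γ (λ z → ∑T m (λ x → F (λ i → b ∙ (z ∷ x) i)))
      ≈⟨ ΣΓ-cong (λ z → ΣTuple-cong m (λ x → F-resp {λ i → b ∙ (z ∷ x) i} {(b ∙ z) ∷ (λ i → b ∙ x i)}
                                               (λ { zero → ≡.refl ; (suc i) → ≡.refl }))) ⟩
    ∑Γ (λ z → ∑T m (λ x → F ((b ∙ z) ∷ (λ i → b ∙ x i))))
      ≈⟨ ΣΓ-cong (λ z → ΣTuple-translate m b (λ x → F ((b ∙ z) ∷ x))
                          (λ x≗y → F-resp (∷-cong-≗ (b ∙ z) x≗y))) ⟩
    ∑Γ (λ z → ∑T m (λ x → F ((b ∙ z) ∷ x)))
      ≈⟨ ΣΓ-translate b (λ w → ∑T m (λ x → F (w ∷ x))) ⟩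
    ∑Γ (λ z → ∑T m (λ x → F (z ∷ x)))
      ∎

  ΣTuple-diagonal : ∀ m (F : Vector G (suc m) → Carrier) → F Preserves _≗_ ⟶ _≈_ →
    ∑T (suc m) F ≈ ∑Γ (λ b → ∑T m (λ y → F (λ i → b ∙ 0∷ y i)))
  ΣTuple-diagonal m F F-resp = ΣΓ-cong (λ b → sym (begin
    ∑T m (λ y → F (λ i → b ∙ 0∷ y i))
      ≈⟨ ΣTuple-cong m (λ y → F-resp {λ i → b ∙ 0∷ y i} {b ∷ (λ i → b ∙ y i)}
                                        (λ { zero → ∙-identityʳ b ; (suc i) → ≡.refl })) ⟩
    ∑T m (λ y → F (b ∷ (λ i → b ∙ y i)))
      ≈⟨ ΣTuple-translate m b (λ y → F (b ∷ y)) (λ x≗y → F-resp (∷-cong-≗ b x≗y)) ⟩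
    ∑T m (λ y → F (b ∷ y))
      ∎))

  prodFin-ΣΓ : ∀ n (h : Fin n → G → Carrier) →
    ∏ n (λ i → ∑Γ (h i)) ≈ ∑T n (λ u → ∏ n (λ i → h i (u i)))
  prodFin-ΣΓ zero    h = refl
  prodFin-ΣΓ (suc n) h = begin
    ∑Γ (h zero) * ∏ n (λ i → ∑Γ (h (suc i)))
      ≈⟨ *-congˡ (prodFin-ΣΓ n (h ∘ suc)) ⟩
    ∑Γ (h zero) * ∑T n (λ u → ∏ n (λ i → h (suc i) (u i)))
      ≈⟨ ΣΓ-distribʳ _ (h zero) ⟩
    ∑Γ (λ z → h zero z * ∑T n (λ u → ∏ n (λ i → h (suc i) (u i))))
      ≈⟨ ΣΓ-cong (λ z → ΣTuple-distribˡ n (h zero z) (λ u → ∏ n (λ i → h (suc i) (u i)))) ⟩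
    ∑T (suc n) (λ u → ∏ (suc n) (λ i → h i (u i)))
      ∎

  prodFin-ΣΓ-diagonal : ∀ n (h : Fin (suc n) → G → Carrier) →
    ∏ (suc n) (λ i → ∑Γ (h i)) ≈ ∑Γ (λ b → ∑T n (λ y → ∏ (suc n) (λ i → h i (b ∙ 0∷ y i))))
  prodFin-ΣΓ-diagonal n h =
    trans (prodFin-ΣΓ (suc n) h)
          (ΣTuple-diagonal n (λ u → ∏ (suc n) (λ i → h i (u i)))
            (λ u≗v → prodFin-cong (suc n) (λ i → reflexive (≡.cong (h i) (u≗v i)))))

  ΣTuple-𝒞 : ∀ n (h : Fin (suc n) → G → Carrier) →
    ∑T n (C (suc n) h) ≈ ∏ (suc n) (λ i → ∑Γ (h i))
  ΣTuple-𝒞 n h =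
    trans (ΣTuple-ΣΓ-comm n (λ x z → ∏ (suc n) (λ i → h i (z ∙ 0∷ x i))))
          (sym (prodFin-ΣΓ-diagonal n h))

  𝒞*𝒞 : ∀ n (F H : Fin (suc n) → G → Carrier) x →
    C (suc n) F x * C (suc n) H x ≈ ∑Γ (λ w → C (suc n) (λ i y → F i y * H i (y ∙ w)) x)
  𝒞*𝒞 n F H x = begin
    ∑Γ PF * ∑Γ PH                            ≈⟨ ΣΓ-distribʳ (∑Γ PH) PF ⟩
    ∑Γ (λ z → PF z * ∑Γ PH)                  ≈⟨ ΣΓ-cong (λ z → ΣΓ-distribˡ (PF z) PH) ⟩
    ∑Γ (λ z → ∑Γ (λ u → PF z * PH u))        ≈⟨ ΣΓ-cong (λ z → ΣΓ-translate z (λ u → PF z * PH u)) ⟨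
    ∑Γ (λ z → ∑Γ (λ w → PF z * PH (z ∙ w)))  ≈⟨ ΣΓ-comm (λ z w → PF z * PH (z ∙ w)) ⟩
    ∑Γ (λ w → ∑Γ (λ z → PF z * PH (z ∙ w)))  ≈⟨ ΣΓ-cong (λ w → ΣΓ-cong (λ z → sym (merge z w))) ⟩
    ∑Γ (λ w → C L (λ i y → F i y * H i (y ∙ w)) x) ∎
    where
    L = suc n
    PF PH : G → Carrier
    PF z = ∏ L (λ i → F i (z ∙ 0∷ x i))
    PH z = ∏ L (λ i → H i (z ∙ 0∷ x i))
    merge : ∀ z w → ∏ L (λ i → F i (z ∙ 0∷ x i) * H i ((z ∙ 0∷ x i) ∙ w)) ≈ PF z * PH (z ∙ w)
    merge z w = begin
      ∏ L (λ i → F i (z ∙ 0∷ x i) * H i ((z ∙ 0∷ x i) ∙ w))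
        ≈⟨ prodFin-distrib-* L (λ i → F i (z ∙ 0∷ x i)) (λ i → H i ((z ∙ 0∷ x i) ∙ w)) ⟩
      PF z * ∏ L (λ i → H i ((z ∙ 0∷ x i) ∙ w))
        ≈⟨ *-congˡ (prodFin-cong L (λ i → reflexive (≡.cong (H i) (xy∙z≈xz∙y z (0∷ x i) w)))) ⟩
      PF z * PH (z ∙ w)
        ∎

  ΣTuple-𝒞*𝒞 : ∀ n (F H : Fin (suc n) → G → Carrier) →
    ∑T n (λ x → C (suc n) F x * C (suc n) H x) ≈ ∑Γ (λ w → ∏ (suc n) (λ i → _∘Γ_ Γ R (F i) (H i) w))
  ΣTuple-𝒞*𝒞 n F H = begin
    ∑T n (λ x → C (suc n) F x * C (suc n) H x)  ≈⟨ ΣTuple-cong n (𝒞*𝒞 n F H) ⟩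
    ∑T n (λ x → ∑Γ (λ w → C (suc n) (FH w) x))  ≈⟨ ΣTuple-ΣΓ-comm n (λ x w → C (suc n) (FH w) x) ⟩
    ∑Γ (λ w → ∑T n (C (suc n) (FH w)))          ≈⟨ ΣΓ-cong (λ w → ΣTuple-𝒞 n (FH w)) ⟩
    ∑Γ (λ w → ∏ (suc n) (λ i → ∑Γ (FH w i)))    ∎
    where
    FH : G → Fin (suc n) → G → Carrier
    FH w i y = F i y * H i (y ∙ w)

  ΣTuple-prodFin-𝒞 : ∀ n m (f : Fin (suc m) → G → Carrier) →
    ∑T n (λ x → ∏ (suc m) (λ j → C (suc n) (const (f j)) x))
      ≈ ∑T m (λ y → pow Γ R (C (suc m) f y) (suc n))
  ΣTuple-prodFin-𝒞 n m f = begin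
    ∑T n (λ x → ∏ K (λ j → C L (const (f j)) x))
      ≈⟨ ΣTuple-cong n (λ x → prodFin-ΣΓ-diagonal m (λ j z → ∏ L (λ i → f j (z ∙ 0∷ x i)))) ⟩
    ∑T n (λ x → ∑Γ (λ b → ∑T m (λ y → ∏ K (λ j → ∏ L (λ i → f j ((b ∙ 0∷ y j) ∙ 0∷ x i))))))
      ≈⟨ ΣTuple-cong n (λ x → ΣΓ-cong (λ b → ΣTuple-cong m (λ y → swap-factors b x y))) ⟩
    ∑T n (λ x → ∑Γ (λ b → ∑T m (Φ b x)))   ≈⟨ ΣTuple-ΣΓ-comm n (λ x b → ∑T m (Φ b x)) ⟩
    ∑Γ (λ b → ∑T n (λ x → ∑T m (Φ b x)))   ≈⟨ ΣΓ-cong (λ b → ΣTuple-comm n m (Φ b)) ⟩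
    ∑Γ (λ b → ∑T m (λ y → ∑T n (λ x → Φ b x y)))
      ≈⟨ ΣTuple-ΣΓ-comm m (λ y b → ∑T n (λ x → Φ b x y)) ⟨
    ∑T m (λ y → ∑Γ (λ b → ∑T n (λ x → Φ b x y)))
      ≈⟨ ΣTuple-cong m (λ y → prodFin-ΣΓ-diagonal n (λ i z → ∏ K (λ j → f j (z ∙ 0∷ y j)))) ⟨
    ∑T m (λ y → ∏ L (const (C K f y)))
      ≈⟨ ΣTuple-cong m (λ y → pow≈prodFin-const (C K f y) L) ⟨
    ∑T m (λ y → pow Γ R (C K f y) L)
      ∎
    where
    K L : ℕ
    K = suc m
    L = suc n
    Φ : G → Vector G n → Vector G m → Carrier
    Φ b x y = ∏ L (λ i → ∏ K (λ j → f j ((b ∙ 0∷ x i) ∙ 0∷ y j)))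
    swap-factors : ∀ b x y →
      ∏ K (λ j → ∏ L (λ i → f j ((b ∙ 0∷ y j) ∙ 0∷ x i))) ≈ Φ b x y
    swap-factors b x y =
      trans (prodFin-comm K L (λ j i → f j ((b ∙ 0∷ y j) ∙ 0∷ x i)))
            (prodFin-cong L (λ i → prodFin-cong K (λ j →
              reflexive (≡.cong (f j) (xy∙z≈xz∙y b (0∷ y j) (0∷ x i))))))

  0∷-⊕ : ∀ {n} (y x : Vector G n) i → 0∷ (_⊕_ Γ R y x) i ≡ 0∷ y i ∙ 0∷ x i
  0∷-⊕ y x zero    = ≡.sym (∙-identityʳ ε)
  0∷-⊕ y x (suc i) = ≡.refl

  convT-𝒞 : ∀ n (F H : Fin (suc n) → G → Carrier) x →
    convT Γ R n (C (suc n) F) (C (suc n) H) x ≈ C (suc n) (λ i → _∘Γ_ Γ R (F i) (H i)) x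
  convT-𝒞 n F H x = begin
    ∑T n (λ y → C L F y * C L H (_⊕_ Γ R y x))
      ≈⟨ ΣTuple-cong n (λ y → *-congˡ (ΣΓ-cong (λ z → prodFin-cong L (λ i →
           reflexive (≡.cong (H i) (≡.trans (≡.cong (z ∙_) (0∷-⊕ y x i))
                                            (≡.sym (∙-assoc z (0∷ y i) (0∷ x i))))))))) ⟩
    ∑T n (λ y → C L F y * C L Hₓ y)
      ≈⟨ ΣTuple-𝒞*𝒞 n F Hₓ ⟩
    ∑Γ (λ w → ∏ L (λ i → ∑Γ (λ u → F i u * H i ((u ∙ w) ∙ 0∷ x i))))
      ≈⟨ ΣΓ-cong (λ w → prodFin-cong L (λ i → ΣΓ-cong (λ u →
           *-congˡ {F i u} (reflexive (≡.cong (H i) (∙-assoc u w (0∷ x i))))))) ⟩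
    C L (λ i → _∘Γ_ Γ R (F i) (H i)) x
      ∎
    where
    L = suc n
    Hₓ : Fin L → G → Carrier
    Hₓ i v = H i (v ∙ 0∷ x i)

  chainT-𝒞 : ∀ n r (h : Fin (suc r) → G → Carrier) x →
    chainT Γ R n (suc r) (λ j → C (suc n) (const (h j))) x
      ≈ C (suc n) (const (chainΓ Γ R (suc r) h)) x
  chainT-𝒞 n zero    h x = refl
  chainT-𝒞 n (suc r) h x =
    trans (ΣTuple-cong n (λ y → *-congˡ (chainT-𝒞 n r (h ∘ suc) (_⊕_ Γ R y x))))
          (convT-𝒞 n (const (h zero)) (const (chainΓ Γ R (suc r) (h ∘ suc))) x)

  ΣTuple-𝒞*chainT-𝒞 : ∀ n r (h : Fin (suc (suc r)) → G → Carrier) →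
    ∑T n (λ x → C (suc n) (const (h zero)) x
                * chainT Γ R n (suc r) (λ j → C (suc n) (const (h (suc j)))) x)
      ≈ ∑Γ (λ z → pow Γ R (chainΓ Γ R (suc (suc r)) h z) (suc n))
  ΣTuple-𝒞*chainT-𝒞 n r h = begin
    ∑T n (λ x → C L (const (h zero)) x * chainT Γ R n (suc r) (λ j → C L (const (h (suc j)))) x)
      ≈⟨ ΣTuple-cong n (λ x → *-congˡ (chainT-𝒞 n r (h ∘ suc) x)) ⟩
    ∑T n (λ x → C L (const (h zero)) x * C L (const (chainΓ Γ R (suc r) (h ∘ suc))) x)
      ≈⟨ ΣTuple-𝒞*𝒞 n (const (h zero)) (const (chainΓ Γ R (suc r) (h ∘ suc))) ⟩
    ∑Γ (λ z → ∏ L (const (chainΓ Γ R (suc (suc r)) h z)))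
      ≈⟨ ΣΓ-cong (λ z → pow≈prodFin-const (chainΓ Γ R (suc (suc r)) h z) L) ⟨
    ∑Γ (λ z → pow Γ R (chainΓ Γ R (suc (suc r)) h z) L)
      ∎
    where
    L = suc n

corollary5 : ∀ {a c ℓ} (Γ : FiniteAbelianGroup a) (R : CommutativeRing c ℓ)
  (k l : ℕ) (hk : 2 ≤ k) (hl : 2 ≤ l)
  (f : Fin (k ⊔ l) → FiniteAbelianGroup.Carrier Γ → CommutativeRing.Carrier R)
  (g : Fin l → FiniteAbelianGroup.Carrier Γ → CommutativeRing.Carrier R) →
  let _≈_ = CommutativeRing._≈_ R
      _*_ = CommutativeRing._*_ R
      fl = λ (i : Fin l) → f (inject≤ i (m≤n⊔m k l))
      fk = λ (i : Fin k) → f (inject≤ i (m≤m⊔n k l))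
  in (ΣTuple Γ R (pred l) (λ x → (𝒞 Γ R l fl x * 𝒞 Γ R l g x))
        ≈ ΣΓ Γ R (λ z → prodFin Γ R l (λ i → _∘Γ_ Γ R (fl i) (g i) z)))
     × (ΣTuple Γ R (pred l) (λ x → prodFin Γ R k (λ j → 𝒞 Γ R l (λ _ → fk j) x))
        ≈ ΣTuple Γ R (pred k) (λ y → pow Γ R (𝒞 Γ R k fk y) l))
     × (ΣTuple Γ R (pred l)
          (λ x → (𝒞 Γ R l (λ _ → headF (<⇒≤ hk) fk) x)
                 * (chainT Γ R (pred l) (pred k)
                     (λ j → 𝒞 Γ R l (λ _ → tailF fk j)) x))
        ≈ ΣΓ Γ R (λ z → pow Γ R (chainΓ Γ R k fk z) l))
corollary5 Γ R k@(suc (suc r)) l@(suc (suc n)) (s≤s (s≤s _)) (s≤s (s≤s _)) f g =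
    ΣTuple-𝒞*𝒞 Γ R (suc n) fl g
  , ΣTuple-prodFin-𝒞 Γ R (suc n) (suc r) fk
  , ΣTuple-𝒞*chainT-𝒞 Γ R (suc n) r fk
  where
  fl = λ (i : Fin l) → f (inject≤ i (m≤n⊔m k l))
  fk = λ (i : Fin k) → f (inject≤ i (m≤m⊔n k l))
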